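{- Let $b\in\mathcal{F}$, let $T$ be a binary tree on $n$ vertices with orbit $\mathcal{O}$, and suppose that for some vertex $v$ of $T$ the subtree rooted at $v$ (consisting of $v$ and all its descendants) is the complete binary tree of depth $k\ge1$. Let $T'$ be the tree obtained from $T$ by replacing this subtree with the single vertex $v$, and let $\mathcal{O}'$ be the orbit of $T'$. Then for every $m\ge0$, \[\varepsilon_m^{\mathcal{O}}=\varepsilon_0^{\,2^k-2}\,\varepsilon_m^{\mathcal{O}'}.\]
   Context: $(\Delta f)(x)=f(x+1)-f(x)$. $\mathcal{F}$ is the set of functions $f:\mathbb{Z}_{\ge0}\to\mathbb{Z}$ with $2^n\mid(\Delta^nf)(x)$ for all $n\ge0$, $x\ge0$. For $f\in\mathcal{F}$ and $n\ge0$, $\Delta^nf$ is constant modulo $2^{n+1}$ and congruent to $0$ or $2^n$; set $\varepsilon_n^f=0$ in the first case and $1$ in the second. Write $\varepsilon_k=\varepsilon_k^b$ (with $\varepsilon_0^0=1$). A binary tree is a rooted tree in which each vertex has possibly a left child and/or a right child. The group $G_n$ acts on binary trees with $n$ vertices, generated by swapping the left and right subtrees at a vertex; orbits are orbits of this action. For a binary tree $T$ and $x\in\mathbb{Z}_{\ge0}$ let $w_b(T;x)=\prod_{u\in T}b(x+l_u)$, $l_u$ being the number of left edges on the path from the root to $u$; for an orbit $\mathcal{O}$ let $r_b(\mathcal{O};x)=\frac1{|\mathcal{O}|}\sum_{T\in\mathcal{O}}w_b(T;x)$. Each $r_b(\mathcal{O};\cdot)$ belongs to $\mathcal{F}$,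 and $\varepsilon_m^{\mathcal{O}}:=\varepsilon_m^{r_b(\mathcal{O};\cdot)}$. The complete binary tree of depth $k$ is the binary tree with $2^k-1$ vertices in which every vertex at depth $0,1,\dots,k-2$ has two children and every vertex at depth $k-1$ has none. -}

module Defs where

open import Data.Nat as ℕ using (ℕ; zero; suc; _^_; _∸_)
open import Data.Nat.Properties using (m^n≢0)
open import Data.Integer as ℤ using (ℤ; +_; _-_)
open import Data.Integer.DivMod using (_/ℕ_; _%ℕ_)
open import Data.Integer.Divisibility using (_∣_)
open import Data.Bool using (Bool; true; false; if_then_else_)
open import Data.List using (List; []; _∷_; length; map; foldr)
open import Data.Maybe using (Maybe; just; nothing)
open import Data.Product using (_×_)
open import Relation.Nullary.Decidable using (⌊_⌋)
open import Relation.Binary.PropositionalEquality using (_≡_)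
open import Relation.Binary.Construct.Closure.ReflexiveTransitive using (Star)
open import Data.List.Membership.Propositional using (_∈_)
open import Data.List.Relation.Unary.Unique.Propositional using (Unique)

Δ : (ℕ → ℤ) → (ℕ → ℤ)
Δ f x = f (suc x) - f x

Δ^ : ℕ → (ℕ → ℤ) → (ℕ → ℤ)
Δ^ zero    f = f
Δ^ (suc n) f = Δ (Δ^ n f)

In𝓕 : (ℕ → ℤ) → Set
In𝓕 f = ∀ (n x : ℕ) → (+ (2 ^ n)) ∣ Δ^ n f x

-- ε_n^f ∈ {0,1}: for f ∈ 𝓕, Δ^n f is constant mod 2^(n+1) and ≡ 0 or 2^n
-- there; we read off this constant residue at x = 0.
ε : (ℕ → ℤ) → ℕ → ℕ
ε f n with (Δ^ n f 0 %ℕ (2 ^ suc n)) {{m^n≢0 2 (suc n)}}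
... | zero  = 0
... | suc _ = 1

data BTree : Set where
  ∅    : BTree
  node : BTree → BTree → BTree

size : BTree → ℕ
size ∅          = 0
size (node l r) = suc (size l ℕ.+ size r)

-- complete binary tree of depth k (2^k - 1 vertices)
complete : ℕ → BTree
complete zero    = ∅
complete (suc k) = node (complete k) (complete k)

-- vertices are addressed by paths from the root; false = go left, true = go right
Path : Set
Path = List Bool

subtreeAt : BTree → Path → Maybe BTree
subtreeAt ∅          _            = nothing
subtreeAt (node l r) []           = just (node l r)
subtreeAt (node l r) (false ∷ p)  = subtreeAt l p
subtreeAt (node l r) (true  ∷ p)  = subtreeAt r p

replaceAt : BTree → Path → BTree → BTree
replaceAt ∅          _           S = ∅
replaceAt (node l r) []          S = S
replaceAt (node l r) (false ∷ p) S = node (replaceAt l p S) r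
replaceAt (node l r) (true  ∷ p) S = node l (replaceAt r p S)

-- generator of the action: swap left/right subtrees at one vertex
data Swap : BTree → BTree → Set where
  swap-here  : ∀ {l r}    → Swap (node l r) (node r l)
  swap-left  : ∀ {l l' r} → Swap l l' → Swap (node l r) (node l' r)
  swap-right : ∀ {l r r'} → Swap r r' → Swap (node l r) (node l r')

IsOrbitOf : BTree → List BTree → Set
IsOrbitOf T O = Unique O × (∀ T' → (T' ∈ O → Star Swap T T') × (Star Swap T T' → T' ∈ O))

-- w_b(T;x) = ∏_{u ∈ T} b(x + l_u), l_u = number of left edges root → u
w : (ℕ → ℤ) → BTree → ℕ → ℤ
w b ∅          x = + 1
w b (node l r) x = b x ℤ.* (w b l (suc x) ℤ.* w b r x)

sumℤ : List ℤ → ℤ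
sumℤ = foldr ℤ._+_ (+ 0)

-- r_b(O;x) = (1/|O|) Σ_{T∈O} w_b(T;x)  (an integer, by the paper)
r : (ℕ → ℤ) → List BTree → ℕ → ℤ
r b []        x = + 0
r b (T ∷ Ts)  x = sumℤ (map (λ S → w b S x) (T ∷ Ts)) /ℕ length (T ∷ Ts)

-- Write 𝓕[ a ] f for "2^(a+n) ∣ Δⁿ f x for all n, x", so 𝓕 = 𝓕[ 0 ].  These
-- classes are closed under sums, Δ and doubling/exact halving, and multiply by
-- a discrete Leibniz rule (𝓕[ a ]·𝓕[ c ] ⊆ 𝓕[ a + c ]).  Consequently, if
-- f ≡ c·g (mod 𝓕[ 1 ]) with g ∈ 𝓕, then ε_m f = (c mod 2)·ε_m g  (ε-scale).
--
-- After enumerating orbits explicitly, the orbit average r_b(O(T)) becomes the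
-- recursively defined ρ T, with ρ(node l r)(x) = b(x)·(ρ l ⋆ ρ r)(x) where
-- (u ⋆ v)(x) = (u(x+1)v(x) + v(x+1)u(x))/2  (r≡ρ).  Congruences mod 𝓕[ 1 ]
-- propagate from a subtree to the whole tree (ρ-replace); a complete tree of
-- depth k+2 satisfies ρ ≡ u(0)²·ρ(single vertex) with u(0) ≡ b(0) (mod 2)
-- (complete-collapse, complete-root≡₂).
module Submission where

open import Data.Nat as ℕ using (ℕ; zero; suc; _^_; _∸_; s≤s)
import Data.Nat.Properties as ℕP
import Data.Nat.Divisibility as ℕD
import Data.Nat.DivMod as ℕDM
open import Data.Integer as ℤ using (ℤ; +_; _+_; _*_; _-_; ∣_∣)
import Data.Integer.Properties as ℤP
open import Data.Integer.DivMod using (_%ℕ_; _/ℕ_; a≡a%ℕn+[a/ℕn]*n; n%ℕd<d)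
open import Data.Integer.Divisibility.Signed
  using (_∣_; divides; ∣-refl; ∣ᵤ⇒∣; ∣⇒∣ᵤ; ∣m∣n⇒∣m+n; ∣m∣n⇒∣m-n; ∣n⇒∣m*n; ∣m⇒∣m*n;
         *-monoʳ-∣; *-cancelˡ-∣)
open import Data.Integer.Tactic.RingSolver using (solve-∀)
open import Algebra.Bundles using (CommutativeMonoid)
open import Data.Bool using (true; false)
open import Data.Empty using (⊥-elim)
open import Data.Maybe using (just)
open import Data.Product using (_×_; _,_; proj₁; proj₂)
open import Data.Sum using (_⊎_; inj₁; inj₂)
open import Data.List using (List; []; _∷_; _++_; map; length; cartesianProductWith)
import Data.List.Properties as LP
open import Data.List.Relation.Unary.Any using (here)
import Data.List.Relation.Unary.All as All
open import Data.List.Membership.Propositional using (_∈_)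
open import Data.List.Membership.Propositional.Properties
  using (∈-++⁺ˡ; ∈-++⁺ʳ; ∈-++⁻; ∈-cartesianProductWith⁺; ∈-cartesianProductWith⁻)
open import Data.List.Membership.Propositional.Properties.WithK using (unique∧set⇒bag)
open import Data.List.Relation.Unary.Unique.Propositional using (Unique; []; _∷_)
import Data.List.Relation.Unary.Unique.Propositional.Properties as Unique
open import Data.List.Relation.Binary.BagAndSetEquality using (∼bag⇒↭)
open import Data.List.Relation.Binary.Permutation.Propositional using (_↭_; ↭⇒↭ₛ)
open import Data.List.Relation.Binary.Permutation.Propositional.Properties
  using (↭-length) renaming (map⁺ to ↭-map⁺)
open import Data.List.Relation.Binary.Permutation.Setoid.Properties using (foldr-commMonoid)
open import Function.Bundles using (mk⇔)
open import Relation.Nullary using (Dec; yes; no; ¬_)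
open import Relation.Binary.Construct.Closure.ReflexiveTransitive as Star using (Star; _◅_; _◅◅_)
open import Relation.Binary.PropositionalEquality

open import Defs

two^ : ℕ → ℤ
two^ n = + (2 ^ n)

two^-+ : ∀ a c → two^ (a ℕ.+ c) ≡ two^ a * two^ c
two^-+ a c = trans (cong +_ (ℕP.^-distribˡ-+-* 2 a c)) (ℤP.pos-* (2 ^ a) (2 ^ c))

two^-suc : ∀ a → two^ (suc a) ≡ + 2 * two^ a
two^-suc a = ℤP.pos-* 2 (2 ^ a)

∣-* : ∀ {a c x y} → a ∣ x → c ∣ y → a * c ∣ x * y
∣-* {a} {c} (divides p refl) (divides q refl) = divides (p * q) (regroup p a q c)
  where regroup : ∀ p a q c → p * a * (q * c) ≡ p * q * (a * c)
        regroup = solve-∀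

two^-∣-cast : ∀ {a a' z} → a ≡ a' → two^ a ∣ z → two^ a' ∣ z
two^-∣-cast refl d = d

∣0 : ∀ d → d ∣ + 0
∣0 d = divides (+ 0) (sym (ℤP.*-zeroˡ d))

Δ^-cong : ∀ n {f g : ℕ → ℤ} → (∀ x → f x ≡ g x) → ∀ x → Δ^ n f x ≡ Δ^ n g x
Δ^-cong zero    f≗g x = f≗g x
Δ^-cong (suc n) f≗g x = cong₂ _-_ (Δ^-cong n f≗g (suc x)) (Δ^-cong n f≗g x)

Δ^-Δ : ∀ n f x → Δ^ n (Δ f) x ≡ Δ^ (suc n) f x
Δ^-Δ zero    f x = refl
Δ^-Δ (suc n) f x = cong₂ _-_ (Δ^-Δ n f (suc x)) (Δ^-Δ n f x)

Δ^-shift : ∀ n f x → Δ^ n (λ y → f (suc y)) x ≡ Δ^ n f (suc x)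
Δ^-shift zero    f x = refl
Δ^-shift (suc n) f x = cong₂ _-_ (Δ^-shift n f (suc x)) (Δ^-shift n f x)

Δ^-+ : ∀ n f g x → Δ^ n (λ y → f y + g y) x ≡ Δ^ n f x + Δ^ n g x
Δ^-+ zero    f g x = refl
Δ^-+ (suc n) f g x =
  trans (cong₂ _-_ (Δ^-+ n f g (suc x)) (Δ^-+ n f g x))
        (interchange (Δ^ n f (suc x)) (Δ^ n g (suc x)) (Δ^ n f x) (Δ^ n g x))
  where interchange : ∀ a b c d → (a + b) - (c + d) ≡ (a - c) + (b - d)
        interchange = solve-∀

Δ^-- : ∀ n f g x → Δ^ n (λ y → f y - g y) x ≡ Δ^ n f x - Δ^ n g x
Δ^-- zero    f g x = refl
Δ^-- (suc n) f g x =
  trans (cong₂ _-_ (Δ^-- n f g (suc x)) (Δ^-- n f g x))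
        (interchange (Δ^ n f (suc x)) (Δ^ n g (suc x)) (Δ^ n f x) (Δ^ n g x))
  where interchange : ∀ a b c d → (a - b) - (c - d) ≡ (a - c) - (b - d)
        interchange = solve-∀

Δ^-scale : ∀ n k f x → Δ^ n (λ y → k * f y) x ≡ k * Δ^ n f x
Δ^-scale zero    k f x = refl
Δ^-scale (suc n) k f x =
  trans (cong₂ _-_ (Δ^-scale n k f (suc x)) (Δ^-scale n k f x)) (factor k (Δ^ n f (suc x)) (Δ^ n f x))
  where factor : ∀ k a c → k * a - k * c ≡ k * (a - c)
        factor = solve-∀

Δ^-const : ∀ n c x → Δ^ (suc n) (λ _ → c) x ≡ + 0
Δ^-const n c x = begin
  Δ^ (suc n) (λ _ → c) x        ≡⟨ Δ^-Δ n (λ _ → c) x ⟨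
  Δ^ n (λ _ → c - c) x          ≡⟨ Δ^-cong n (λ _ → ℤP.+-inverseʳ c) x ⟩
  Δ^ n (λ _ → + 0 * c) x        ≡⟨ Δ^-scale n (+ 0) (λ _ → c) x ⟩
  + 0                           ∎
  where open ≡-Reasoning

record 𝓕[_] (a : ℕ) (f : ℕ → ℤ) : Set where
  constructor mk𝓕
  field Δ^-divisible : ∀ n x → two^ (a ℕ.+ n) ∣ Δ^ n f x
open 𝓕[_]

𝓕-cong : ∀ {a f g} → (∀ x → f x ≡ g x) → 𝓕[ a ] f → 𝓕[ a ] g
𝓕-cong f≗g (mk𝓕 F) = mk𝓕 λ n x → subst (_ ∣_) (Δ^-cong n f≗g x) (F n x)

𝓕-level : ∀ {a a' f} → a ≡ a' → 𝓕[ a ] f → 𝓕[ a' ] f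
𝓕-level refl F = F

𝓕-+ : ∀ {a f g} → 𝓕[ a ] f → 𝓕[ a ] g → 𝓕[ a ] (λ y → f y + g y)
𝓕-+ {f = f} {g} (mk𝓕 F) (mk𝓕 G) =
  mk𝓕 λ n x → subst (_ ∣_) (sym (Δ^-+ n f g x)) (∣m∣n⇒∣m+n (F n x) (G n x))

𝓕-- : ∀ {a f g} → 𝓕[ a ] f → 𝓕[ a ] g → 𝓕[ a ] (λ y → f y - g y)
𝓕-- {f = f} {g} (mk𝓕 F) (mk𝓕 G) =
  mk𝓕 λ n x → subst (_ ∣_) (sym (Δ^-- n f g x)) (∣m∣n⇒∣m-n (F n x) (G n x))

𝓕-double : ∀ {a f} → 𝓕[ a ] f → 𝓕[ suc a ] (λ y → + 2 * f y)
𝓕-double {a} {f} (mk𝓕 F) = mk𝓕 λ n x →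
  subst₂ _∣_ (sym (two^-suc (a ℕ.+ n))) (sym (Δ^-scale n (+ 2) f x)) (*-monoʳ-∣ (+ 2) (F n x))

𝓕-halve : ∀ {a f g} → (∀ x → f x ≡ + 2 * g x) → 𝓕[ suc a ] f → 𝓕[ a ] g
𝓕-halve {a} {f} {g} f≡2g (mk𝓕 F) = mk𝓕 λ n x →
  *-cancelˡ-∣ (+ 2) (subst₂ _∣_ (two^-suc (a ℕ.+ n))
                               (trans (Δ^-cong n f≡2g x) (Δ^-scale n (+ 2) g x)) (F n x))

𝓕-Δ : ∀ {a f} → 𝓕[ a ] f → 𝓕[ suc a ] (Δ f)
𝓕-Δ {a} {f} (mk𝓕 F) = mk𝓕 λ n x →
  subst₂ (λ e v → two^ e ∣ v) (ℕP.+-suc a n) (sym (Δ^-Δ n f x)) (F (suc n) x)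

𝓕-fromΔ : ∀ {a f} → (∀ x → two^ a ∣ f x) → 𝓕[ suc a ] (Δ f) → 𝓕[ a ] f
𝓕-fromΔ {a} {f} 2^a∣f (mk𝓕 F) = mk𝓕 go
  where
  go : ∀ n x → two^ (a ℕ.+ n) ∣ Δ^ n f x
  go zero    x = two^-∣-cast (sym (ℕP.+-identityʳ a)) (2^a∣f x)
  go (suc n) x = subst₂ (λ e v → two^ e ∣ v) (sym (ℕP.+-suc a n)) (Δ^-Δ n f x) (F n x)

𝓕-shift : ∀ {a f} → 𝓕[ a ] f → 𝓕[ a ] (λ y → f (suc y))
𝓕-shift {f = f} (mk𝓕 F) = mk𝓕 λ n x → subst (_ ∣_) (sym (Δ^-shift n f x)) (F n (suc x))

𝓕-const : ∀ c → 𝓕[ 0 ] (λ _ → c)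
𝓕-const c = mk𝓕 λ where
  zero    x → divides c (sym (ℤP.*-identityʳ c))
  (suc n) x → subst (_ ∣_) (sym (Δ^-const n c x)) (∣0 _)

-- Discrete Leibniz rule: Δ(fg)(x) = Δf(x)·g(x+1) + f(x)·Δg(x), so levels add.
𝓕-* : ∀ {a c f g} → 𝓕[ a ] f → 𝓕[ c ] g → 𝓕[ a ℕ.+ c ] (λ y → f y * g y)
𝓕-* F G = mk𝓕 λ n → leibniz n F G
  where
  leibniz : ∀ n {a c f g} → 𝓕[ a ] f → 𝓕[ c ] g →
            ∀ x → two^ ((a ℕ.+ c) ℕ.+ n) ∣ Δ^ n (λ y → f y * g y) x
  leibniz zero {a} {c} {f} {g} F G x =
    two^-∣-cast (sym (ℕP.+-identityʳ (a ℕ.+ c)))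
      (subst (_∣ f x * g x) (sym (two^-+ a c))
        (∣-* (two^-∣-cast (ℕP.+-identityʳ a) (Δ^-divisible F 0 x))
             (two^-∣-cast (ℕP.+-identityʳ c) (Δ^-divisible G 0 x))))
  leibniz (suc n) {a} {c} {f} {g} F G x =
    subst₂ (λ e v → two^ e ∣ v) (sym (ℕP.+-suc (a ℕ.+ c) n)) (step-Δ f g x)
      (∣m∣n⇒∣m+n (leibniz n (𝓕-Δ F) (𝓕-shift G) x)
                 (two^-∣-cast (cong (ℕ._+ n) (ℕP.+-suc a c)) (leibniz n F (𝓕-Δ G) x)))
    where
    leibniz-identity : ∀ f1 f0 g1 g0 → f1 * g1 - f0 * g0 ≡ (f1 - f0) * g1 + f0 * (g1 - g0)
    leibniz-identity = solve-∀
    step-Δ : ∀ f g x → Δ^ n (λ y → Δ f y * g (suc y)) x + Δ^ n (λ y → f y * Δ g y) x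
                       ≡ Δ^ (suc n) (λ y → f y * g y) x
    step-Δ f g x = begin
      Δ^ n (λ y → Δ f y * g (suc y)) x + Δ^ n (λ y → f y * Δ g y) x
        ≡⟨ Δ^-+ n _ _ x ⟨
      Δ^ n (λ y → Δ f y * g (suc y) + f y * Δ g y) x
        ≡⟨ Δ^-cong n (λ y → sym (leibniz-identity (f (suc y)) (f y) (g (suc y)) (g y))) x ⟩
      Δ^ n (Δ (λ y → f y * g y)) x
        ≡⟨ Δ^-Δ n _ x ⟩
      Δ^ (suc n) (λ y → f y * g y) x ∎
      where open ≡-Reasoning

small-multiple≡0 : ∀ {d n} → n ℕ.< d → d ℕD.∣ n → n ≡ 0
small-multiple≡0 {n = zero}  _   _   = refl
small-multiple≡0 {n = suc _} n<d d∣n = ⊥-elim (ℕP.<⇒≱ n<d (ℕD.∣⇒≤ d∣n))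

residue-unique-≤ : ∀ {d r₁ r₂} → r₁ ℕ.≤ r₂ → r₂ ℕ.< d → d ℕD.∣ ∣ r₁ ℤ.⊖ r₂ ∣ → r₁ ≡ r₂
residue-unique-≤ {d} {r₁} {r₂} r₁≤r₂ r₂<d d∣ = ℕP.≤-antisym r₁≤r₂ (ℕP.m∸n≡0⇒m≤n r₂∸r₁≡0)
  where
  r₂∸r₁≡0 : r₂ ∸ r₁ ≡ 0
  r₂∸r₁≡0 = small-multiple≡0 (ℕP.≤-<-trans (ℕP.m∸n≤m r₂ r₁) r₂<d)
                             (subst (d ℕD.∣_) (ℤP.∣⊖∣-≤ r₁≤r₂) d∣)

residue-unique : ∀ d {r₁ r₂} → r₁ ℕ.< d → r₂ ℕ.< d → + d ∣ + r₁ - + r₂ → r₁ ≡ r₂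
residue-unique d {r₁} {r₂} r₁<d r₂<d d∣r₁-r₂ = by-order (ℕP.≤-total r₁ r₂)
  where
  d∣∣r₁⊖r₂∣ : d ℕD.∣ ∣ r₁ ℤ.⊖ r₂ ∣
  d∣∣r₁⊖r₂∣ = subst (λ z → d ℕD.∣ ∣ z ∣) (ℤP.[+m]-[+n]≡m⊖n r₁ r₂) (∣⇒∣ᵤ d∣r₁-r₂)
  by-order : r₁ ℕ.≤ r₂ ⊎ r₂ ℕ.≤ r₁ → r₁ ≡ r₂
  by-order (inj₁ r₁≤r₂) = residue-unique-≤ r₁≤r₂ r₂<d d∣∣r₁⊖r₂∣
  by-order (inj₂ r₂≤r₁) =
    sym (residue-unique-≤ r₂≤r₁ r₁<d (subst (d ℕD.∣_) (ℤP.∣m⊖n∣≡∣n⊖m∣ r₁ r₂) d∣∣r₁⊖r₂∣))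

%ℕ-cong : ∀ d .{{_ : ℕ.NonZero d}} {X Y} → + d ∣ X - Y → X %ℕ d ≡ Y %ℕ d
%ℕ-cong d {X} {Y} d∣X-Y =
  residue-unique d (n%ℕd<d X d) (n%ℕd<d Y d)
    (subst (+ d ∣_) residues (∣m∣n⇒∣m-n d∣X-Y (∣n⇒∣m*n (X /ℕ d - Y /ℕ d) ∣-refl)))
  where
  cancel-quotients : ∀ a b qX qY D → (a + qX * D - (b + qY * D)) - (qX - qY) * D ≡ a - b
  cancel-quotients = solve-∀
  residues : X - Y - (X /ℕ d - Y /ℕ d) * + d ≡ + (X %ℕ d) - + (Y %ℕ d)
  residues = trans (cong₂ (λ x y → x - y - (X /ℕ d - Y /ℕ d) * + d)
                          (a≡a%ℕn+[a/ℕn]*n X d) (a≡a%ℕn+[a/ℕn]*n Y d))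
                   (cancel-quotients (+ (X %ℕ d)) (+ (Y %ℕ d)) (X /ℕ d) (Y /ℕ d) (+ d))

%ℕ-multiple : ∀ d .{{_ : ℕ.NonZero d}} {X} → + d ∣ X → X %ℕ d ≡ 0
%ℕ-multiple d {X} d∣X =
  trans (%ℕ-cong d {X} {+ 0} (subst (+ d ∣_) (sym (ℤP.+-identityʳ X)) d∣X)) (ℕDM.m*n%n≡0 0 d)

/ℕ-exact : ∀ d .{{_ : ℕ.NonZero d}} {X} → + d ∣ X → X ≡ + d * (X /ℕ d)
/ℕ-exact d {X} d∣X = begin
  X                              ≡⟨ a≡a%ℕn+[a/ℕn]*n X d ⟩
  + (X %ℕ d) + (X /ℕ d) * + d    ≡⟨ cong (λ r → + r + (X /ℕ d) * + d) (%ℕ-multiple d d∣X) ⟩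
  + 0 + (X /ℕ d) * + d           ≡⟨ ℤP.+-identityˡ _ ⟩
  (X /ℕ d) * + d                 ≡⟨ ℤP.*-comm (X /ℕ d) (+ d) ⟩
  + d * (X /ℕ d)                 ∎
  where open ≡-Reasoning

/ℕ-cancel : ∀ d .{{_ : ℕ.NonZero d}} R → (+ d * R) /ℕ d ≡ R
/ℕ-cancel d R = sym (ℤP.*-cancelˡ-≡ (+ d) R ((+ d * R) /ℕ d) (/ℕ-exact d (divides R (ℤP.*-comm (+ d) R))))

bit : ℕ → ℕ
bit zero    = 0
bit (suc _) = 1

parity : ℤ → ℕ
parity z = bit (z %ℕ 2)

even-or-odd : ∀ z → (+ 2 ∣ z) ⊎ (+ 2 ∣ z - + 1)
even-or-odd z with z %ℕ 2 | n%ℕd<d z 2 | a≡a%ℕn+[a/ℕn]*n z 2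
... | 0           | _               | z≡ = inj₁ (divides (z /ℕ 2) (trans z≡ (ℤP.+-identityˡ _)))
... | 1           | _               | z≡ = inj₂ (divides (z /ℕ 2) (trans (cong (_- + 1) z≡) (drop-one (z /ℕ 2))))
  where drop-one : ∀ q → + 1 + q * + 2 - + 1 ≡ q * + 2
        drop-one = solve-∀
... | suc (suc _) | s≤s (s≤s ())  | _

parity-cong : ∀ {c d} → + 2 ∣ c - d → parity c ≡ parity d
parity-cong {c} {d} 2∣c-d = cong bit (%ℕ-cong 2 {c} {d} 2∣c-d)

parity-even : ∀ {c} → + 2 ∣ c → parity c ≡ 0
parity-even {c} 2∣c = cong bit (%ℕ-multiple 2 {c} 2∣c)

parity-odd : ∀ {c} → + 2 ∣ c - + 1 → parity c ≡ 1
parity-odd {c} = parity-cong {c} {+ 1}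

bit-pow : ∀ n {e} → 0 ℕ.< e → bit n ^ e ≡ bit n
bit-pow zero    {suc e} _ = refl
bit-pow (suc _) {suc e} _ = ℕP.^-zeroˡ (suc e)

ε-unfold : ∀ f m → ε f m ≡ bit ((Δ^ m f 0 %ℕ (2 ^ suc m)) {{ℕP.m^n≢0 2 (suc m)}})
ε-unfold f m with (Δ^ m f 0 %ℕ (2 ^ suc m)) {{ℕP.m^n≢0 2 (suc m)}}
... | zero  = refl
... | suc _ = refl

ε-at-0 : ∀ f → ε f 0 ≡ parity (f 0)
ε-at-0 f = ε-unfold f 0

ε-cong : ∀ {f g} m → two^ (suc m) ∣ Δ^ m f 0 - Δ^ m g 0 → ε f m ≡ ε g m
ε-cong {f} {g} m d∣ = begin
  ε f m                                               ≡⟨ ε-unfold f m ⟩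
  bit ((Δ^ m f 0 %ℕ (2 ^ suc m)) {{2^m+1≢0}})         ≡⟨ cong bit (%ℕ-cong (2 ^ suc m) {{2^m+1≢0}} {Δ^ m f 0} {Δ^ m g 0} d∣) ⟩
  bit ((Δ^ m g 0 %ℕ (2 ^ suc m)) {{2^m+1≢0}})         ≡⟨ ε-unfold g m ⟨
  ε g m                                               ∎
  where open ≡-Reasoning
        2^m+1≢0 = ℕP.m^n≢0 2 (suc m)

ε-vanish : ∀ {f} m → two^ (suc m) ∣ Δ^ m f 0 → ε f m ≡ 0
ε-vanish {f} m d∣ =
  trans (ε-unfold f m) (cong bit (%ℕ-multiple (2 ^ suc m) {{ℕP.m^n≢0 2 (suc m)}} {Δ^ m f 0} d∣))

ε-ext : ∀ {f g} m → (∀ x → f x ≡ g x) → ε f m ≡ ε g m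
ε-ext {f} {g} m f≗g = ε-cong {f} {g} m
  (subst (λ z → two^ (suc m) ∣ z - Δ^ m g 0) (sym (Δ^-cong m f≗g 0))
    (subst (two^ (suc m) ∣_) (sym (ℤP.+-inverseʳ (Δ^ m g 0))) (∣0 _)))

ε-scale : ∀ {f g} c m → 𝓕[ 0 ] g → 𝓕[ 1 ] (λ x → f x - c * g x) → ε f m ≡ parity c ℕ.* ε g m
ε-scale {f} {g} c m G D = by-parity (even-or-odd c)
  where
  2^m+1∣Δ[f-cg] : two^ (suc m) ∣ Δ^ m f 0 - c * Δ^ m g 0
  2^m+1∣Δ[f-cg] = subst (_ ∣_) (trans (Δ^-- m f _ 0) (cong (_-_ (Δ^ m f 0)) (Δ^-scale m c g 0)))
                    (Δ^-divisible D m 0)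
  2^m+1∣e·Δg : ∀ {e} → + 2 ∣ e → two^ (suc m) ∣ e * Δ^ m g 0
  2^m+1∣e·Δg {e} 2∣e = subst (_∣ e * Δ^ m g 0) (sym (two^-+ 1 m)) (∣-* 2∣e (Δ^-divisible G m 0))
  move-right : ∀ a b → (a - b) + b ≡ a
  move-right = solve-∀
  regroup : ∀ a b c → (a - c * b) + (c - + 1) * b ≡ a - b
  regroup = solve-∀
  by-parity : (+ 2 ∣ c) ⊎ (+ 2 ∣ c - + 1) → ε f m ≡ parity c ℕ.* ε g m
  by-parity (inj₁ 2∣c) = begin
    ε f m             ≡⟨ ε-vanish {f} m (subst (_ ∣_) (move-right (Δ^ m f 0) (c * Δ^ m g 0))
                                        (∣m∣n⇒∣m+n 2^m+1∣Δ[f-cg] (2^m+1∣e·Δg 2∣c))) ⟩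
    0 ℕ.* ε g m       ≡⟨ cong (ℕ._* ε g m) (parity-even {c} 2∣c) ⟨
    parity c ℕ.* ε g m  ∎
    where open ≡-Reasoning
  by-parity (inj₂ 2∣c-1) = begin
    ε f m             ≡⟨ ε-cong {f} {g} m (subst (_ ∣_) (regroup (Δ^ m f 0) (Δ^ m g 0) c)
                                    (∣m∣n⇒∣m+n 2^m+1∣Δ[f-cg] (2^m+1∣e·Δg 2∣c-1))) ⟩
    ε g m             ≡⟨ ℕP.*-identityˡ (ε g m) ⟨
    1 ℕ.* ε g m       ≡⟨ cong (ℕ._* ε g m) (parity-odd {c} 2∣c-1) ⟨
    parity c ℕ.* ε g m  ∎
    where open ≡-Reasoning

-- Two trees lie in the same orbit iff they are related by _~_: at each vertex
-- the two subtrees are matched either in order (keep) or swapped (flip).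

infix 4 _~_
data _~_ : BTree → BTree → Set where
  ∅~∅  : ∅ ~ ∅
  keep : ∀ {p q s t} → p ~ s → q ~ t → node p q ~ node s t
  flip : ∀ {p q s t} → p ~ t → q ~ s → node p q ~ node s t

~-refl : ∀ T → T ~ T
~-refl ∅          = ∅~∅
~-refl (node l r) = keep (~-refl l) (~-refl r)

~-sym : ∀ {T U} → T ~ U → U ~ T
~-sym ∅~∅        = ∅~∅
~-sym (keep p q) = keep (~-sym p) (~-sym q)
~-sym (flip p q) = flip (~-sym q) (~-sym p)

~-trans : ∀ {T U V} → T ~ U → U ~ V → T ~ V
~-trans ∅~∅        ∅~∅        = ∅~∅
~-trans (keep p q) (keep r s) = keep (~-trans p r) (~-trans q s)
~-trans (keep p q) (flip r s) = flip (~-trans p r) (~-trans q s)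
~-trans (flip p q) (keep r s) = flip (~-trans p s) (~-trans q r)
~-trans (flip p q) (flip r s) = keep (~-trans p s) (~-trans q r)

_~?_ : ∀ T U → Dec (T ~ U)
∅        ~? ∅        = yes ∅~∅
∅        ~? node _ _ = no λ ()
node _ _ ~? ∅        = no λ ()
node p q ~? node s t with p ~? s | q ~? t | p ~? t | q ~? s
... | yes p~s | yes q~t | _       | _       = yes (keep p~s q~t)
... | _       | _       | yes p~t | yes q~s = yes (flip p~t q~s)
... | no p≁s  | _       | no p≁t  | _       = no λ { (keep x _) → p≁s x ; (flip x _) → p≁t x }
... | no p≁s  | _       | yes _   | no q≁s  = no λ { (keep x _) → p≁s x ; (flip _ y) → q≁s y }
... | yes _   | no q≁t  | no p≁t  | _       = no λ { (keep _ y) → q≁t y ; (flip x _) → p≁t x }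
... | yes _   | no q≁t  | yes _   | no q≁s  = no λ { (keep _ y) → q≁t y ; (flip _ y) → q≁s y }

Swap⇒~ : ∀ {T U} → Swap T U → T ~ U
Swap⇒~ {node l r} swap-here      = flip (~-refl l) (~-refl r)
Swap⇒~ {node l r} (swap-left s)  = keep (Swap⇒~ s) (~-refl r)
Swap⇒~ {node l r} (swap-right s) = keep (~-refl l) (Swap⇒~ s)

Swaps⇒~ : ∀ {T U} → Star Swap T U → T ~ U
Swaps⇒~ {T} Star.ε = ~-refl T
Swaps⇒~ (s ◅ ss)   = ~-trans (Swap⇒~ s) (Swaps⇒~ ss)

swaps-left : ∀ {p s} q → Star Swap p s → Star Swap (node p q) (node s q)
swaps-left q = Star.gmap (λ p → node p q) swap-left

swaps-right : ∀ p {q t} → Star Swap q t → Star Swap (node p q) (node p t)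
swaps-right p = Star.gmap (node p) swap-right

~⇒Swaps : ∀ {T U} → T ~ U → Star Swap T U
~⇒Swaps ∅~∅ = Star.ε
~⇒Swaps {node p q} {node s t} (keep p~s q~t) =
  swaps-left q (~⇒Swaps p~s) ◅◅ swaps-right s (~⇒Swaps q~t)
~⇒Swaps {node p q} {node s t} (flip p~t q~s) =
  swaps-left q (~⇒Swaps p~t) ◅◅ swaps-right t (~⇒Swaps q~s) ◅◅ swap-here ◅ Star.ε

-- Explicit duplicate-free enumeration of the orbit of a tree: the orbit of
-- node p q consists of the trees node x y with (x, y) ∈ O(p) × O(q), together
-- with node y x when p ≁ q; when p ~ q these are already all of them.

pairs : List BTree → List BTree → List BTree
pairs = cartesianProductWith node

orbit-by : ∀ {P : Set} → Dec P → List BTree → List BTree → List BTree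
orbit-by (yes _) A C = pairs A A
orbit-by (no _)  A C = pairs A C ++ pairs C A

orbit : BTree → List BTree
orbit ∅          = ∅ ∷ []
orbit (node p q) = orbit-by (p ~? q) (orbit p) (orbit q)

length-pairs : ∀ L M → length (pairs L M) ≡ length L ℕ.* length M
length-pairs []      M = refl
length-pairs (y ∷ L) M =
  trans (LP.length-++ (map (node y) M)) (cong₂ ℕ._+_ (LP.length-map (node y) M) (length-pairs L M))

∈-pairs⁺ : ∀ {x y L M} → x ∈ L → y ∈ M → node x y ∈ pairs L M
∈-pairs⁺ = ∈-cartesianProductWith⁺ node

orbit-sound : ∀ T {z} → z ∈ orbit T → z ~ T
orbit-sound ∅ (here refl) = ∅~∅
orbit-sound (node p q) z∈ with p ~? q
... | yes p~q with ∈-cartesianProductWith⁻ node (orbit p) (orbit p) z∈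
...   | _ , _ , x∈ , y∈ , refl = keep (orbit-sound p x∈) (~-trans (orbit-sound p y∈) p~q)
orbit-sound (node p q) z∈ | no _ with ∈-++⁻ (pairs (orbit p) (orbit q)) z∈
... | inj₁ z∈pq with ∈-cartesianProductWith⁻ node (orbit p) (orbit q) z∈pq
...   | _ , _ , x∈ , y∈ , refl = keep (orbit-sound p x∈) (orbit-sound q y∈)
orbit-sound (node p q) z∈ | no _ | inj₂ z∈qp with ∈-cartesianProductWith⁻ node (orbit q) (orbit p) z∈qp
...   | _ , _ , x∈ , y∈ , refl = flip (orbit-sound q x∈) (orbit-sound p y∈)

orbit-complete : ∀ T {z} → z ~ T → z ∈ orbit T
orbit-complete ∅ ∅~∅ = here refl
orbit-complete (node p q) z~T with p ~? q
orbit-complete (node p q) (keep x~p y~q) | yes p~q =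
  ∈-pairs⁺ (orbit-complete p x~p) (orbit-complete p (~-trans y~q (~-sym p~q)))
orbit-complete (node p q) (flip x~q y~p) | yes p~q =
  ∈-pairs⁺ (orbit-complete p (~-trans x~q (~-sym p~q))) (orbit-complete p y~p)
orbit-complete (node p q) (keep x~p y~q) | no _ =
  ∈-++⁺ˡ (∈-pairs⁺ (orbit-complete p x~p) (orbit-complete q y~q))
orbit-complete (node p q) (flip x~q y~p) | no _ =
  ∈-++⁺ʳ (pairs (orbit p) (orbit q)) (∈-pairs⁺ (orbit-complete q x~q) (orbit-complete p y~p))

pairs-unique : ∀ {L M} → Unique L → Unique M → Unique (pairs L M)
pairs-unique = Unique.cartesianProductWith⁺ node node-injective
  where node-injective : ∀ {w x y z} → node w y ≡ node x z → w ≡ x × y ≡ z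
        node-injective refl = refl , refl

orbit-unique : ∀ T → Unique (orbit T)
orbit-unique ∅ = All.[] ∷ []
orbit-unique (node p q) with p ~? q
... | yes _ = pairs-unique (orbit-unique p) (orbit-unique p)
... | no p≁q = Unique.++⁺ (pairs-unique (orbit-unique p) (orbit-unique q))
                          (pairs-unique (orbit-unique q) (orbit-unique p)) disjoint
  where
  disjoint : ∀ {v} → ¬ (v ∈ pairs (orbit p) (orbit q) × v ∈ pairs (orbit q) (orbit p))
  disjoint (v∈pq , v∈qp)
    with ∈-cartesianProductWith⁻ node (orbit p) (orbit q) v∈pq | ∈-cartesianProductWith⁻ node (orbit q) (orbit p) v∈qp
  ... | _ , _ , x∈p , _ , refl | _ , _ , x∈q , _ , refl =
    p≁q (~-trans (~-sym (orbit-sound p x∈p)) (orbit-sound q x∈q))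

orbit-↭ : ∀ {T O} → IsOrbitOf T O → O ↭ orbit T
orbit-↭ {T} (O-unique , O-members) =
  ∼bag⇒↭ (unique∧set⇒bag O-unique (orbit-unique T) λ {z} → mk⇔
    (λ z∈O     → orbit-complete T (~-sym (Swaps⇒~ (proj₁ (O-members z) z∈O))))
    (λ z∈orbit → proj₂ (O-members z) (~⇒Swaps (~-sym (orbit-sound T z∈orbit)))))

infix 4 _≡₂_
_≡₂_ : ℤ → ℤ → Set
x ≡₂ y = + 2 ∣ x - y

≡₂-refl : ∀ x → x ≡₂ x
≡₂-refl x = subst (_ ∣_) (sym (ℤP.+-inverseʳ x)) (∣0 _)

≡₂-trans : ∀ {x y z} → x ≡₂ y → y ≡₂ z → x ≡₂ z
≡₂-trans {x} {y} {z} x≡y y≡z = subst (_ ∣_) (telescope x y z) (∣m∣n⇒∣m+n x≡y y≡z)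
  where telescope : ∀ x y z → (x - y) + (y - z) ≡ x - z
        telescope = solve-∀

≡₂-* : ∀ {x y u v} → x ≡₂ y → u ≡₂ v → x * u ≡₂ y * v
≡₂-* {x} {y} {u} {v} x≡y u≡v =
  subst (_ ∣_) (expand x y u v) (∣m∣n⇒∣m+n (∣n⇒∣m*n x u≡v) (∣n⇒∣m*n v x≡y))
  where expand : ∀ x y u v → x * (u - v) + v * (x - y) ≡ x * u - y * v
        expand = solve-∀

square≡₂ : ∀ x → x * x ≡₂ x
square≡₂ x with even-or-odd x
... | inj₁ 2∣x   = ∣m∣n⇒∣m-n (∣m⇒∣m*n x 2∣x) 2∣x
... | inj₂ 2∣x-1 = subst (_ ∣_) (x[x-1] x) (∣n⇒∣m*n x 2∣x-1)
  where x[x-1] : ∀ x → x * (x - + 1) ≡ x * x - x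
        x[x-1] = solve-∀

𝓕-constant-mod-2 : ∀ {u} → 𝓕[ 0 ] u → ∀ x → u x ≡₂ u 0
𝓕-constant-mod-2 {u} U zero    = ≡₂-refl (u 0)
𝓕-constant-mod-2 {u} U (suc x) =
  ≡₂-trans {u (suc x)} {u x} {u 0} (Δ^-divisible U 1 x) (𝓕-constant-mod-2 U x)

cross : (ℕ → ℤ) → (ℕ → ℤ) → ℕ → ℤ
cross u v x = u (suc x) * v x + v (suc x) * u x

infixl 7 _⋆_
_⋆_ : (ℕ → ℤ) → (ℕ → ℤ) → ℕ → ℤ
(u ⋆ v) x = cross u v x /ℕ 2

-- cross u v = 2·u·v + Δu·v + u·Δv, so it gains one level of divisibility.
𝓕-cross : ∀ {a e u v} → 𝓕[ a ] u → 𝓕[ e ] v → 𝓕[ suc (a ℕ.+ e) ] (cross u v)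
𝓕-cross {a} {e} {u} {v} U V =
  𝓕-cong (λ x → sym (expand (u (suc x)) (u x) (v (suc x)) (v x)))
    (𝓕-+ (𝓕-double (𝓕-* U V))
         (𝓕-+ (𝓕-* (𝓕-Δ U) V) (𝓕-level (ℕP.+-suc a e) (𝓕-* U (𝓕-Δ V)))))
  where expand : ∀ u1 u0 v1 v0 → u1 * v0 + v1 * u0 ≡ + 2 * (u0 * v0) + ((u1 - u0) * v0 + u0 * (v1 - v0))
        expand = solve-∀

cross-halves : ∀ {u v} → 𝓕[ 0 ] u → 𝓕[ 0 ] v → ∀ x → cross u v x ≡ + 2 * (u ⋆ v) x
cross-halves U V x = /ℕ-exact 2 (Δ^-divisible (𝓕-cross U V) 0 x)

𝓕-⋆ : ∀ {u v} → 𝓕[ 0 ] u → 𝓕[ 0 ] v → 𝓕[ 0 ] (u ⋆ v)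
𝓕-⋆ U V = 𝓕-halve (cross-halves U V) (𝓕-cross U V)

⋆-comm : ∀ u v x → (u ⋆ v) x ≡ (v ⋆ u) x
⋆-comm u v x = cong (_/ℕ 2) (ℤP.+-comm (u (suc x) * v x) (v (suc x) * u x))

⋆-cong : ∀ {u u' v v'} → (∀ x → u x ≡ u' x) → (∀ x → v x ≡ v' x) → ∀ x → (u ⋆ v) x ≡ (u' ⋆ v') x
⋆-cong u≗u' v≗v' x =
  cong (_/ℕ 2) (cong₂ _+_ (cong₂ _*_ (u≗u' (suc x)) (v≗v' x)) (cong₂ _*_ (v≗v' (suc x)) (u≗u' x)))

⋆-diag : ∀ u x → (u ⋆ u) x ≡ u (suc x) * u x
⋆-diag u x = trans (cong (_/ℕ 2) (double (u (suc x) * u x))) (/ℕ-cancel 2 (u (suc x) * u x))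
  where double : ∀ p → p + p ≡ + 2 * p
        double = solve-∀

⋆-congˡ-mod : ∀ {u u' w} c → 𝓕[ 0 ] u → 𝓕[ 0 ] u' → 𝓕[ 0 ] w →
              𝓕[ 1 ] (λ x → u x - c * u' x) → 𝓕[ 1 ] (λ x → (u ⋆ w) x - c * (u' ⋆ w) x)
⋆-congˡ-mod {u} {u'} {w} c U U' W D =
  𝓕-halve (λ x → trans (cong₂ (λ p q → p - c * q) (cross-halves U W x) (cross-halves U' W x))
                       (factor-2 ((u ⋆ w) x) ((u' ⋆ w) x) c))
    (𝓕-cong (λ x → sym (regroup (u (suc x)) (u x) (w (suc x)) (w x) (u' (suc x)) (u' x) c))
      (𝓕-cross D W))
  where
  factor-2 : ∀ p q c → + 2 * p - c * (+ 2 * q) ≡ + 2 * (p - c * q)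
  factor-2 = solve-∀
  regroup : ∀ u1 u0 w1 w0 v1 v0 c →
            (u1 * w0 + w1 * u0) - c * (v1 * w0 + w1 * v0) ≡ (u1 - c * v1) * w0 + w1 * (u0 - c * v0)
  regroup = solve-∀

⋆-diag-mod : ∀ {u} → 𝓕[ 0 ] u → 𝓕[ 1 ] (λ x → (u ⋆ u) x - u 0 * u 0)
⋆-diag-mod {u} U =
  𝓕-cong (λ x → sym (trans (cong (_- (u 0 * u 0)) (⋆-diag u x)) (split (u (suc x)) (u x) (u 0 * u 0))))
    (𝓕-+ (𝓕-* U (𝓕-Δ U)) u²-u0²)
  where
  split : ∀ u1 u0 c → u1 * u0 - c ≡ u0 * (u1 - u0) + (u0 * u0 - c)
  split = solve-∀
  difference-of-squares : ∀ u1 u0 c → (u1 * u1 - c) - (u0 * u0 - c) ≡ (u1 - u0) * (+ 2 * u0 + (u1 - u0))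
  difference-of-squares = solve-∀
  -- u² − u(0)² is even everywhere and its difference is Δu·(2u + Δu).
  u²-u0² : 𝓕[ 1 ] (λ x → u x * u x - u 0 * u 0)
  u²-u0² = 𝓕-fromΔ (λ x → ≡₂-* {u x} {u 0} {u x} {u 0} (𝓕-constant-mod-2 U x) (𝓕-constant-mod-2 U x))
             (𝓕-cong (λ x → sym (difference-of-squares (u (suc x)) (u x) (u 0 * u 0)))
               (𝓕-* (𝓕-Δ U) (𝓕-+ (𝓕-double U) (𝓕-Δ U))))

replace-self : ∀ T v {S} → subtreeAt T v ≡ just S → replaceAt T v S ≡ T
replace-self ∅          v           ()
replace-self (node l r) []          refl = refl
replace-self (node l r) (false ∷ v) S∈l  = cong (λ l' → node l' r) (replace-self l v S∈l)
replace-self (node l r) (true ∷ v)  S∈r  = cong (node l) (replace-self r v S∈r)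

sumℤ-↭ : ∀ {xs ys} → xs ↭ ys → sumℤ xs ≡ sumℤ ys
sumℤ-↭ p = foldr-commMonoid ℤ+.setoid ℤ+.isCommutativeMonoid (↭⇒↭ₛ p)
  where module ℤ+ = CommutativeMonoid ℤP.+-0-commutativeMonoid

module OrbitAverage (b : ℕ → ℤ) (b∈𝓕 : 𝓕[ 0 ] b) where

  -- ρ T computes the orbit average r_b(O(T)) by recursion on T (see r≡ρ).
  ρ : BTree → ℕ → ℤ
  ρ ∅          x = + 1
  ρ (node l r) x = b x * (ρ l ⋆ ρ r) x

  𝓕-ρ : ∀ T → 𝓕[ 0 ] (ρ T)
  𝓕-ρ ∅          = 𝓕-const (+ 1)
  𝓕-ρ (node l r) = 𝓕-* b∈𝓕 (𝓕-⋆ (𝓕-ρ l) (𝓕-ρ r))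

  ρ-~ : ∀ {T U} → T ~ U → ∀ x → ρ T x ≡ ρ U x
  ρ-~ ∅~∅        x = refl
  ρ-~ (keep p q) x = cong (b x *_) (⋆-cong (ρ-~ p) (ρ-~ q) x)
  ρ-~ {node p q} {node s t} (flip p~t q~s) x =
    cong (b x *_) (trans (⋆-cong (ρ-~ p~t) (ρ-~ q~s) x) (⋆-comm (ρ t) (ρ s) x))

  factor : ∀ b p q c → b * p - c * (b * q) ≡ b * (p - c * q)
  factor = solve-∀

  ρ-replace : ∀ T v {S} S' c → subtreeAt T v ≡ just S →
              𝓕[ 1 ] (λ x → ρ S x - c * ρ S' x) →
              𝓕[ 1 ] (λ x → ρ T x - c * ρ (replaceAt T v S') x)
  ρ-replace ∅          v           S' c ()   D
  ρ-replace (node l r) []          S' c refl D = D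
  ρ-replace (node l r) (false ∷ v) S' c S∈l D =
    𝓕-cong (λ x → sym (factor (b x) ((ρ l ⋆ ρ r) x) ((ρ l' ⋆ ρ r) x) c))
      (𝓕-* b∈𝓕 (⋆-congˡ-mod c (𝓕-ρ l) (𝓕-ρ l') (𝓕-ρ r) (ρ-replace l v S' c S∈l D)))
    where l' = replaceAt l v S'
  ρ-replace (node l r) (true ∷ v)  S' c S∈r D =
    𝓕-cong (λ x → sym (trans (factor (b x) ((ρ l ⋆ ρ r) x) ((ρ l ⋆ ρ r') x) c)
                             (cong (b x *_) (cong₂ (λ s t → s - c * t) (⋆-comm (ρ l) (ρ r) x)
                                                                        (⋆-comm (ρ l) (ρ r') x)))))
      (𝓕-* b∈𝓕 (⋆-congˡ-mod c (𝓕-ρ r) (𝓕-ρ r') (𝓕-ρ l) (ρ-replace r v S' c S∈r D)))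
    where r' = replaceAt r v S'

  -- For the complete tree C of depth k+2 with half C' of depth k+1,
  -- ρ C = b·(ρ C' ⋆ ρ C') ≡ ρ C'(0)²·b = ρ C'(0)²·ρ(single vertex)  (mod 𝓕[ 1 ]).
  complete-collapse : ∀ k → let u = ρ (complete (suc k)) in
    𝓕[ 1 ] (λ x → ρ (complete (suc (suc k))) x - (u 0 * u 0) * ρ (node ∅ ∅) x)
  complete-collapse k =
    𝓕-cong (λ x → sym (factor-1 (b x) ((u ⋆ u) x) (u 0 * u 0)))
      (𝓕-* b∈𝓕 (⋆-diag-mod (𝓕-ρ (complete (suc k)))))
    where
    u = ρ (complete (suc k))
    factor-1 : ∀ b q c → b * q - c * (b * + 1) ≡ b * (q - c)
    factor-1 = solve-∀

  complete-root≡₂ : ∀ j → ρ (complete (suc j)) 0 ≡₂ b 0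
  complete-root≡₂ zero    = subst (_≡₂ b 0) (sym (ℤP.*-identityʳ (b 0))) (≡₂-refl (b 0))
  complete-root≡₂ (suc j) =
    subst (_≡₂ b 0) (sym (cong (b 0 *_) (⋆-diag v 0)))
      (≡₂-trans {b 0 * (v 1 * v 0)} {b 0 * (b 0 * b 0)} {b 0}
        (≡₂-* {b 0} {b 0} (≡₂-refl (b 0)) (≡₂-* {v 1} {b 0} {v 0} {b 0} v1≡b0 (complete-root≡₂ j)))
        (≡₂-trans {b 0 * (b 0 * b 0)} {b 0 * b 0} {b 0}
          (≡₂-* {b 0} {b 0} (≡₂-refl (b 0)) (square≡₂ (b 0))) (square≡₂ (b 0))))
    where
    v = ρ (complete (suc j))
    v1≡b0 : v 1 ≡₂ b 0
    v1≡b0 = ≡₂-trans {v 1} {v 0} {b 0} (𝓕-constant-mod-2 (𝓕-ρ (complete (suc j))) 1) (complete-root≡₂ j)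

  total : List BTree → ℕ → ℤ
  total L x = sumℤ (map (λ S → w b S x) L)

  total-++ : ∀ L M x → total (L ++ M) x ≡ total L x + total M x
  total-++ []      M x = sym (ℤP.+-identityˡ (total M x))
  total-++ (S ∷ L) M x =
    trans (cong (_+_ (w b S x)) (total-++ L M x)) (sym (ℤP.+-assoc (w b S x) (total L x) (total M x)))

  total-pairs : ∀ L M x → total (pairs L M) x ≡ b x * (total L (suc x) * total M x)
  total-pairs []      M x = sym (ℤP.*-zeroʳ (b x))
  total-pairs (y ∷ L) M x = begin
    total (map (node y) M ++ pairs L M) x
      ≡⟨ total-++ (map (node y) M) (pairs L M) x ⟩
    total (map (node y) M) x + total (pairs L M) x
      ≡⟨ cong₂ _+_ (total-row M) (total-pairs L M x) ⟩
    b x * (w b y (suc x) * total M x) + b x * (total L (suc x) * total M x)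
      ≡⟨ distribute (b x) (w b y (suc x)) (total L (suc x)) (total M x) ⟩
    b x * ((w b y (suc x) + total L (suc x)) * total M x) ∎
    where
    open ≡-Reasoning
    distribute : ∀ B W S T → B * (W * T) + B * (S * T) ≡ B * ((W + S) * T)
    distribute = solve-∀
    total-row : ∀ M → total (map (node y) M) x ≡ b x * (w b y (suc x) * total M x)
    total-row []      = sym (trans (cong (b x *_) (ℤP.*-zeroʳ (w b y (suc x)))) (ℤP.*-zeroʳ (b x)))
    total-row (z ∷ M) =
      trans (cong (_+_ (w b (node y z) x)) (total-row M))
            (expand (b x) (w b y (suc x)) (w b z x) (total M x))
      where expand : ∀ B W V S → B * (W * V) + B * (W * S) ≡ B * (W * (V + S))
            expand = solve-∀

  Averages : List BTree → (ℕ → ℤ) → Set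
  Averages A f = ∀ x → total A x ≡ + length A * f x

  total-pairs-avg : ∀ {A C f g} → Averages A f → Averages C g →
                    ∀ x → total (pairs A C) x ≡ + (length A ℕ.* length C) * (b x * (f (suc x) * g x))
  total-pairs-avg {A} {C} {f} {g} avgA avgC x = begin
    total (pairs A C) x                                   ≡⟨ total-pairs A C x ⟩
    b x * (total A (suc x) * total C x)                   ≡⟨ cong (b x *_) (cong₂ _*_ (avgA (suc x)) (avgC x)) ⟩
    b x * ((+ length A * f (suc x)) * (+ length C * g x)) ≡⟨ regroup (b x) (+ length A) (+ length C) (f (suc x)) (g x) ⟩
    (+ length A * + length C) * (b x * (f (suc x) * g x)) ≡⟨ cong (_* (b x * (f (suc x) * g x))) (ℤP.pos-* (length A) (length C)) ⟨
    + (length A ℕ.* length C) * (b x * (f (suc x) * g x)) ∎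
    where
    open ≡-Reasoning
    regroup : ∀ B La Lc f1 g0 → B * ((La * f1) * (Lc * g0)) ≡ (La * Lc) * (B * (f1 * g0))
    regroup = solve-∀

  orbit-averages : ∀ T → Averages (orbit T) (ρ T)
  orbit-averages ∅          x = refl
  orbit-averages (node p q) with p ~? q
  ... | yes p~q = λ x → begin
    total (pairs A A) x                                         ≡⟨ total-pairs-avg {A} {A} {ρ p} {ρ p} avgA avgA x ⟩
    + (length A ℕ.* length A) * (b x * (ρ p (suc x) * ρ p x))   ≡⟨ cong₂ (λ n y → + n * (b x * y)) (sym (length-pairs A A)) (sym (⋆-diag (ρ p) x)) ⟩
    + length (pairs A A) * (b x * (ρ p ⋆ ρ p) x)                ≡⟨ cong (λ y → + length (pairs A A) * (b x * y)) (⋆-cong {ρ p} {ρ p} {ρ p} {ρ q} (λ _ → refl) (ρ-~ p~q) x) ⟩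
    + length (pairs A A) * ρ (node p q) x                       ∎
    where
    open ≡-Reasoning
    A = orbit p
    avgA = orbit-averages p
  ... | no _ = λ x → begin
    total (pairs A C ++ pairs C A) x
      ≡⟨ total-++ (pairs A C) (pairs C A) x ⟩
    total (pairs A C) x + total (pairs C A) x
      ≡⟨ cong₂ _+_ (total-pairs-avg {A} {C} {ρ p} {ρ q} avgA avgC x)
                   (total-pairs-avg {C} {A} {ρ q} {ρ p} avgC avgA x) ⟩
    + L * (b x * (ρ p (suc x) * ρ q x)) + + (Lc ℕ.* La) * (b x * (ρ q (suc x) * ρ p x))
      ≡⟨ cong (λ n → + L * (b x * (ρ p (suc x) * ρ q x)) + + n * (b x * (ρ q (suc x) * ρ p x)))
              (ℕP.*-comm Lc La) ⟩
    + L * (b x * (ρ p (suc x) * ρ q x)) + + L * (b x * (ρ q (suc x) * ρ p x))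
      ≡⟨ collect (+ L) (b x) (ρ p (suc x) * ρ q x) (ρ q (suc x) * ρ p x) ⟩
    + L * (b x * cross (ρ p) (ρ q) x)
      ≡⟨ cong (λ y → + L * (b x * y)) (cross-halves (𝓕-ρ p) (𝓕-ρ q) x) ⟩
    + L * (b x * (+ 2 * (ρ p ⋆ ρ q) x))
      ≡⟨ double (+ L) (b x) ((ρ p ⋆ ρ q) x) ⟩
    (+ L + + L) * ρ (node p q) x
      ≡⟨ cong (_* ρ (node p q) x) length-orbit ⟩
    + length (pairs A C ++ pairs C A) * ρ (node p q) x ∎
    where
    open ≡-Reasoning
    A = orbit p
    C = orbit q
    La = length A
    Lc = length C
    L = La ℕ.* Lc
    avgA = orbit-averages p
    avgC = orbit-averages q
    collect : ∀ L B P Q → L * (B * P) + L * (B * Q) ≡ L * (B * (P + Q))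
    collect = solve-∀
    double : ∀ L B s → L * (B * (+ 2 * s)) ≡ (L + L) * (B * s)
    double = solve-∀
    length-orbit : + L + + L ≡ + length (pairs A C ++ pairs C A)
    length-orbit = begin
      + L + + L                                   ≡⟨ ℤP.pos-+ L L ⟨
      + (L ℕ.+ L)                                 ≡⟨ cong₂ (λ m n → + (m ℕ.+ n)) (length-pairs A C)
                                                           (trans (length-pairs C A) (ℕP.*-comm Lc La)) ⟨
      + (length (pairs A C) ℕ.+ length (pairs C A)) ≡⟨ cong +_ (LP.length-++ (pairs A C)) ⟨
      + length (pairs A C ++ pairs C A)           ∎

  r≡ρ : ∀ {T O} → IsOrbitOf T O → ∀ x → r b O x ≡ ρ T x
  r≡ρ {T} {O} O-orbit x = average O (orbit-↭ O-orbit) (proj₂ (proj₂ O-orbit T) Star.ε)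
    where
    average : ∀ O → O ↭ orbit T → T ∈ O → r b O x ≡ ρ T x
    average []       _        ()
    average (S ∷ Ss) O↭orbit _ = begin
      total (S ∷ Ss) x /ℕ suc (length Ss)                   ≡⟨ cong (_/ℕ suc (length Ss)) total≡ ⟩
      (+ suc (length Ss) * ρ T x) /ℕ suc (length Ss)        ≡⟨ /ℕ-cancel (suc (length Ss)) (ρ T x) ⟩
      ρ T x                                                 ∎
      where
      open ≡-Reasoning
      total≡ : total (S ∷ Ss) x ≡ + suc (length Ss) * ρ T x
      total≡ = begin
        total (S ∷ Ss) x                      ≡⟨ sumℤ-↭ (↭-map⁺ (λ U → w b U x) O↭orbit) ⟩
        total (orbit T) x                     ≡⟨ orbit-averages T x ⟩
        + length (orbit T) * ρ T x            ≡⟨ cong (λ n → + n * ρ T x) (↭-length O↭orbit) ⟨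
        + suc (length Ss) * ρ T x             ∎

  collapse-ε : ∀ T v k m → subtreeAt T v ≡ just (complete (suc (suc k))) →
               ε (ρ T) m ≡ parity (b 0) ℕ.* ε (ρ (replaceAt T v (node ∅ ∅))) m
  collapse-ε T v k m C∈T = begin
    ε (ρ T) m                    ≡⟨ ε-scale c m (𝓕-ρ T') (ρ-replace T v (node ∅ ∅) c C∈T (complete-collapse k)) ⟩
    parity c ℕ.* ε (ρ T') m      ≡⟨ cong (ℕ._* ε (ρ T') m) (parity-cong {c} {b 0} c≡₂b0) ⟩
    parity (b 0) ℕ.* ε (ρ T') m  ∎
    where
    open ≡-Reasoning
    T' = replaceAt T v (node ∅ ∅)
    u0 = ρ (complete (suc k)) 0
    c = u0 * u0
    c≡₂b0 : c ≡₂ b 0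
    c≡₂b0 = ≡₂-trans {c} {u0} {b 0} (square≡₂ u0) (complete-root≡₂ k)

  collapse : ∀ T v k m → subtreeAt T v ≡ just (complete (suc k)) →
             ε (ρ T) m ≡ ε b 0 ^ (2 ^ suc k ∸ 2) ℕ.* ε (ρ (replaceAt T v (node ∅ ∅))) m
  -- depth 1: the subtree already is a single vertex and the exponent is 0
  collapse T v zero m C∈T =
    trans (cong (λ U → ε (ρ U) m) (sym (replace-self T v C∈T))) (sym (ℕP.*-identityˡ _))
  -- depth k+2: the factor parity(b(0)) = ε_0(b) equals its positive power
  collapse T v (suc k) m C∈T = begin
    ε (ρ T) m                               ≡⟨ collapse-ε T v k m C∈T ⟩
    parity (b 0) ℕ.* ε (ρ T') m             ≡⟨ cong (ℕ._* ε (ρ T') m) (bit-pow (b 0 %ℕ 2) exponent>0) ⟨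
    parity (b 0) ^ e ℕ.* ε (ρ T') m         ≡⟨ cong (λ z → z ^ e ℕ.* ε (ρ T') m) (ε-at-0 b) ⟨
    ε b 0 ^ e ℕ.* ε (ρ T') m                ∎
    where
    open ≡-Reasoning
    T' = replaceAt T v (node ∅ ∅)
    e = 2 ^ suc (suc k) ∸ 2
    exponent>0 : 0 ℕ.< e
    exponent>0 = ℕP.m<n⇒0<n∸m (ℕP.^-monoʳ-< 2 (s≤s (s≤s ℕ.z≤n)) {1} {suc (suc k)} (s≤s (s≤s ℕ.z≤n)))

lemma2p11 : (b : ℕ → ℤ) → In𝓕 b →
            (n : ℕ) (T : BTree) → size T ≡ n →
            (O : List BTree) → IsOrbitOf T O →
            (v : Path) (k : ℕ) → subtreeAt T v ≡ just (complete (suc k)) →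
            (O' : List BTree) → IsOrbitOf (replaceAt T v (node ∅ ∅)) O' →
            (m : ℕ) →
            ε (r b O) m ≡ (ε b 0) ^ (2 ^ suc k ∸ 2) ℕ.* ε (r b O') m
lemma2p11 b b∈𝓕 _ T _ O O-orbit v k C∈T O' O'-orbit m = begin
  ε (r b O) m                                       ≡⟨ ε-ext m (r≡ρ O-orbit) ⟩
  ε (ρ T) m                                         ≡⟨ collapse T v k m C∈T ⟩
  ε b 0 ^ (2 ^ suc k ∸ 2) ℕ.* ε (ρ T') m            ≡⟨ cong (ε b 0 ^ (2 ^ suc k ∸ 2) ℕ.*_) (ε-ext m (r≡ρ O'-orbit)) ⟨
  ε b 0 ^ (2 ^ suc k ∸ 2) ℕ.* ε (r b O') m          ∎
  where
  open ≡-Reasoning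
  open OrbitAverage b (mk𝓕 λ n x → ∣ᵤ⇒∣ (b∈𝓕 n x))
  T' = replaceAt T v (node ∅ ∅)
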